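{- Let $k\ge2$, $n\ge1$, let $l_1,\ldots,l_k$ be positive integers, $L=l_1+\cdots+l_k$, and let $\pi=s_1\cdots s_{nL}$ be an $n$-configuration path for the $(l_1,\ldots,l_k)$-tennis ball problem. (a) If $i<j$, $s_i=e_l$, $s_j=e_m$ with $l\le m$, then the path obtained from $\pi$ by exchanging steps $s_i$ and $s_j$ is an $n$-configuration path. (b) Let $\pi'=s_1\cdots s_p$ be an initial segment of $\pi$ containing $t'_j$ steps equal to $e_j$ for each $1\le j\le k$, and let $n'$ be the minimum integer such that $t'_j\le n'l_j$ for all $j$. Then for every integer $n''\ge0$, the path consisting of $\pi'$ followed by $(n'+n'')l_k-t'_k$ steps $e_k$, then $(n'+n'')l_{k-1}-t'_{k-1}$ steps $e_{k-1}$, and so on, ending with $(n'+n'')l_1-t'_1$ steps $e_1$, is an $(n'+n'')$-configuration path.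
   Context: $e_1,\ldots,e_k$ are the unit coordinate vectors of $\mathbb{R}^k$. The $(l_1,\ldots,l_k)$-tennis ball problem: there are balls numbered $1,2,\ldots$ and bins $\Gamma_1,\ldots,\Gamma_k$, initially empty. In turn $t$ ($t=1,2,\ldots$), balls $(t-1)L+1,\ldots,tL$ are put into $\Gamma_1$; then, successively for $j=2,\ldots,k$, exactly $l_j+\cdots+l_k$ of the balls currently in $\Gamma_{j-1}$ (chosen arbitrarily) are moved to $\Gamma_j$. For $N\ge1$, an $N$-configuration is an ordered $k$-partition $(A_1,\ldots,A_k)$ of $[NL]$ such that, for some choice of moves, after $N$ turns $A_j$ is exactly the set of balls in $\Gamma_j$ for every $j$. The associated $N$-configuration path is the lattice path $s_1\cdots s_{NL}$ from the origin to $(Nl_1,\ldots,Nl_k)$ with $s_i=e_j$ whenever $i\in A_j$; an $N$-configuration path is a path arising this way from some $N$-configuration. -}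

module Defs where

open import Data.Nat using (ℕ; zero; suc; _+_; _*_; _∸_; _≤_; _<_)
open import Data.Fin using (Fin; toℕ; _≟_)
open import Data.List using (List; []; _∷_; _++_; replicate; drop; tabulate; lookup; length; take; map; concat; reverse; allFin)
open import Data.Vec using (Vec; toList)
open import Data.Nat.ListAction using (sum)
open import Relation.Binary.PropositionalEquality using (_≡_)
open import Relation.Nullary using (yes; no)

-- Bins Γ_1,…,Γ_k are represented by Fin k (0-based: Γ_{j+1} ↔ index j).
-- A state after t turns is a list of length t·L; its p-th entry is the bin
-- containing ball p+1.  This list is exactly the associated lattice path
-- (step s_i = e_j iff ball i lies in Γ_j).

totalL : {k : ℕ} → Vec ℕ k → ℕ
totalL l = sum (toList l)

-- l_{r+1} + … + l_k  (0-based r), the number of balls moved from bin r-1 to bin r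
tailSum : {k : ℕ} → Vec ℕ k → ℕ → ℕ
tailSum l r = sum (drop r (toList l))

data Move {k : ℕ} (i : ℕ) : ℕ → List (Fin k) → List (Fin k) → Set where
  nil   : Move i 0 [] []
  keep  : ∀ {m xs ys} (x : Fin k) → Move i m xs ys → Move i m (x ∷ xs) (x ∷ ys)
  shift : ∀ {m xs ys} (x y : Fin k) → toℕ x ≡ i → toℕ y ≡ suc i →
          Move i m xs ys → Move i (suc m) (x ∷ xs) (y ∷ ys)

data MovesFrom {k : ℕ} (l : Vec ℕ k) (i : ℕ) : List (Fin k) → List (Fin k) → Set where
  done : ∀ {xs} → k ≤ suc i → MovesFrom l i xs xs
  step : ∀ {xs ys zs} → suc i < k → Move i (tailSum l (suc i)) xs ys →
         MovesFrom l (suc i) ys zs → MovesFrom l i xs zs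

-- Reachable l t s : the state s (assignment of balls 1..tL to bins) can be
-- reached after t turns of the (l_1,…,l_k)-tennis ball problem.
data Reachable {k : ℕ} (l : Vec ℕ k) : ℕ → List (Fin k) → Set where
  start : Reachable l 0 []
  turn  : ∀ {t s s'} (z : Fin k) → toℕ z ≡ 0 →
          Reachable l t s →
          MovesFrom l 0 (s ++ replicate (totalL l) z) s' →
          Reachable l (suc t) s'

ConfigPath : {k : ℕ} → Vec ℕ k → ℕ → List (Fin k) → Set
ConfigPath l N π = Reachable l N π

swapSteps : {A : Set} (π : List A) → Fin (length π) → Fin (length π) → List A
swapSteps π i j = tabulate (λ p → lookup π (sel p))
  where
  sel : Fin (length π) → Fin (length π)
  sel p with p ≟ i | p ≟ j
  ... | yes _ | _     = j
  ... | no _  | yes _ = i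
  ... | no _  | no _  = p

countSteps : {k : ℕ} → Fin k → List (Fin k) → ℕ
countSteps j [] = 0
countSteps j (x ∷ xs) with x ≟ j
... | yes _ = suc (countSteps j xs)
... | no _  = countSteps j xs

completion : {k : ℕ} → Vec ℕ k → ℕ → List (Fin k) → List (Fin k)
completion {k} l N π' =
  concat (map (λ j → replicate (N * Data.Vec.lookup l j ∸ countSteps j π') j)
              (reverse (allFin k)))

{-# OPTIONS --safe #-}
-- Write T v = l_{v+1} + ⋯ + l_k.  After t turns exactly t · T v balls have passed beyond Γ_v, all
-- of them among the first t · L balls; so an N-configuration path has N · T v steps into
-- Γ_{v+1}, …, Γ_k and at least t · T v of them among its first t · L steps (t ≤ N).  Conversely,
-- by induction on N, such an admissible path is reached from an admissible path for N − 1 turns: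
-- among the first (N − 1) · L balls keep, bin by bin from the top, only the earliest (N − 1) · l_j
-- balls of Γ_j and move the others down to Γ_{j−1}; one more turn then leads back to the path.
-- Both parts of the corollary now only concern prefix counts: moving the higher of two steps
-- earlier can only increase them, and the completion appends its steps in decreasing bin order.
module Submission where

open import Defs
open import Data.Nat using (ℕ; zero; suc; _+_; _*_; _∸_; _⊓_; _≤_; _<_; z≤n; s≤s; s≤s⁻¹; _≤?_)
open import Data.Nat.Properties
open import Data.Fin as F using (Fin; toℕ; fromℕ<)
open import Data.Fin.Properties
  using (toℕ-injective; toℕ<n; toℕ-fromℕ<; toℕ-inject₁) renaming (suc-injective to fsuc-injective)
open import Data.Vec using (Vec; toList)
open import Data.Vec.Properties using (length-toList)
open import Data.List
  using (List; []; _∷_; _++_; [_]; length; take; drop; lookup; replicate; tabulate; reverse; concat; map; allFin)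
open import Data.List.Properties
  using ( length-take; length-drop; length-replicate; take-all; take-take; take++drop≡id; drop-all
        ; unfold-reverse; tabulate-cong; tabulate-lookup)
open import Data.List.Relation.Binary.Pointwise as Pointwise using (Pointwise; []; _∷_; Pointwise-length)
open import Data.List.Relation.Unary.All as All using (All; []; _∷_)
import Data.List.Relation.Unary.All.Properties as All
open import Data.List.Relation.Unary.AllPairs using (AllPairs; []; _∷_)
import Data.List.Relation.Unary.AllPairs.Properties as AllPairs
open import Data.Maybe using (fromMaybe)
open import Data.Nat.ListAction using (sum)
open import Data.Product using (∃₂; _×_; _,_; proj₁; proj₂; map₂)
open import Data.Sum using (_⊎_; inj₁; inj₂)
open import Function using (flip; id; _∘_)
open import Relation.Nullary using (yes; no; contradiction)
open import Relation.Binary.PropositionalEquality hiding ([_])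
open import Algebra.Properties.CommutativeSemigroup +-commutativeSemigroup using (x∙yz≈y∙xz)

private
  variable
    A : Set
    k : ℕ

downward-induction : (P : ℕ → Set) (m : ℕ) →
  (∀ v → m ≤ v → P v) → (∀ v → v < m → P (suc v) → P v) → ∀ v → P v
downward-induction P m base descend v = go m v (m≤m+n m v)
  where
  go : ∀ d v → m ≤ d + v → P v
  go zero    v m≤v     = base v m≤v
  go (suc d) v m≤1+d+v with m ≤? v
  ... | yes m≤v = base v m≤v
  ... | no  m≰v = descend v (≰⇒> m≰v) (go d (suc v) (subst (m ≤_) (sym (+-suc d v)) m≤1+d+v))

sum-drop : ∀ v (ns : List ℕ) → sum (drop v ns) ≡ fromMaybe 0 (Data.List.head (drop v ns)) + sum (drop (suc v) ns)
sum-drop zero    []       = refl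
sum-drop zero    (_ ∷ _)  = refl
sum-drop (suc v) []       = refl
sum-drop (suc v) (_ ∷ ns) = sum-drop v ns

take-++ : ∀ q (xs ys : List A) → take q (xs ++ ys) ≡ take q xs ++ take (q ∸ length xs) ys
take-++ zero    []       ys = refl
take-++ zero    (x ∷ xs) ys = refl
take-++ (suc q) []       ys = refl
take-++ (suc q) (x ∷ xs) ys = cong (x ∷_) (take-++ q xs ys)

take-++ˡ : ∀ q (xs ys : List A) → q ≤ length xs → take q (xs ++ ys) ≡ take q xs
take-++ˡ zero    xs       ys _        = refl
take-++ˡ (suc q) (x ∷ xs) ys (s≤s q≤) = cong (x ∷_) (take-++ˡ q xs ys q≤)

take-++ʳ : ∀ q (xs ys : List A) → length xs ≤ q → take q (xs ++ ys) ≡ xs ++ take (q ∸ length xs) ys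
take-++ʳ q xs ys ∣xs∣≤q = trans (take-++ q xs ys) (cong (_++ take (q ∸ length xs) ys) (take-all q xs ∣xs∣≤q))

Pointwise-take : ∀ {R : A → A → Set} q {xs ys} → Pointwise R xs ys → Pointwise R (take q xs) (take q ys)
Pointwise-take zero    _        = []
Pointwise-take (suc q) []       = []
Pointwise-take (suc q) (r ∷ rs) = r ∷ Pointwise-take q rs

Pointwise-replicateˡ : ∀ {R : A → A → Set} {x} → (∀ {y} → R x y) → (ys : List A) →
  Pointwise R (replicate (length ys) x) ys
Pointwise-replicateˡ Rx []       = []
Pointwise-replicateˡ Rx (y ∷ ys) = Rx ∷ Pointwise-replicateˡ Rx ys

All-reverse : ∀ {P : A → Set} {xs} → All P xs → All P (reverse xs)
All-reverse []                      = []
All-reverse {xs = x ∷ xs} (px ∷ pxs) rewrite unfold-reverse x xs = All.++⁺ (All-reverse pxs) (px ∷ [])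

AllPairs-reverse : ∀ {R : A → A → Set} {xs} → AllPairs R xs → AllPairs (flip R) (reverse xs)
AllPairs-reverse []                      = []
AllPairs-reverse {xs = x ∷ xs} (px ∷ pxs) rewrite unfold-reverse x xs =
  AllPairs.++⁺ (AllPairs-reverse pxs) ([] ∷ []) (All-reverse (All.map (_∷ []) px))

-- Counting balls beyond a bin

𝟙≥ : ℕ → Fin k → ℕ
𝟙≥ v x with v ≤? toℕ x
... | yes _ = 1
... | no  _ = 0

-- Bins are numbered from 0, so count≥ v π counts the balls in Γ_{v+1}, …, Γ_k.
count≥ : ℕ → List (Fin k) → ℕ
count≥ v []       = 0
count≥ v (x ∷ xs) = 𝟙≥ v x + count≥ v xs

_≼_ : List (Fin k) → List (Fin k) → Set
_≼_ = Pointwise F._≤_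

𝟙≥-yes : ∀ {v} {x : Fin k} → v ≤ toℕ x → 𝟙≥ v x ≡ 1
𝟙≥-yes {v = v} {x} v≤x with v ≤? toℕ x
... | yes _   = refl
... | no  v≰x = contradiction v≤x v≰x

𝟙≥-no : ∀ {v} {x : Fin k} → toℕ x < v → 𝟙≥ v x ≡ 0
𝟙≥-no {v = v} {x} x<v with v ≤? toℕ x
... | yes v≤x = contradiction v≤x (<⇒≱ x<v)
... | no  _   = refl

𝟙≥-mono : ∀ v {x y : Fin k} → toℕ x ≤ toℕ y → 𝟙≥ v x ≤ 𝟙≥ v y
𝟙≥-mono v {x} x≤y with v ≤? toℕ x
... | yes v≤x = ≤-reflexive (sym (𝟙≥-yes (≤-trans v≤x x≤y)))
... | no  _   = z≤n

𝟙≥-antitone : ∀ {u v} (x : Fin k) → u ≤ v → 𝟙≥ v x ≤ 𝟙≥ u x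
𝟙≥-antitone {v = v} x u≤v with v ≤? toℕ x
... | yes v≤x = ≤-reflexive (sym (𝟙≥-yes (≤-trans u≤v v≤x)))
... | no  _   = z≤n

𝟙≥-suc : ∀ v {x : Fin k} → toℕ x ≢ v → 𝟙≥ v x ≡ 𝟙≥ (suc v) x
𝟙≥-suc v {x} x≢v with v ≤? toℕ x
... | yes v≤x = sym (𝟙≥-yes (≤∧≢⇒< v≤x (≢-sym x≢v)))
... | no  v≰x = sym (𝟙≥-no (m<n⇒m<1+n (≰⇒> v≰x)))

𝟙≥-step : ∀ {i v} {x y : Fin k} → toℕ x ≡ i → toℕ y ≡ suc i → v ≢ suc i → 𝟙≥ v y ≡ 𝟙≥ v x
𝟙≥-step {i = i} {v} x≡i y≡1+i v≢1+i with v ≤? i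
... | yes v≤i = trans (𝟙≥-yes (subst (v ≤_) (sym y≡1+i) (m≤n⇒m≤1+n v≤i)))
                      (sym (𝟙≥-yes (subst (v ≤_) (sym x≡i) v≤i)))
... | no  v≰i = trans (𝟙≥-no (subst (_< v) (sym y≡1+i) (≤∧≢⇒< (≰⇒> v≰i) (≢-sym v≢1+i))))
                      (sym (𝟙≥-no (subst (_< v) (sym x≡i) (≰⇒> v≰i))))

count≥-++ : ∀ v (xs ys : List (Fin k)) → count≥ v (xs ++ ys) ≡ count≥ v xs + count≥ v ys
count≥-++ v []       ys = refl
count≥-++ v (x ∷ xs) ys = trans (cong (𝟙≥ v x +_) (count≥-++ v xs ys)) (sym (+-assoc (𝟙≥ v x) _ _))

count≥-zero : (xs : List (Fin k)) → count≥ 0 xs ≡ length xs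
count≥-zero []       = refl
count≥-zero (x ∷ xs) = cong₂ _+_ (𝟙≥-yes {x = x} z≤n) (count≥-zero xs)

count≥-antitone : ∀ {u v} (xs : List (Fin k)) → u ≤ v → count≥ v xs ≤ count≥ u xs
count≥-antitone []       u≤v = z≤n
count≥-antitone (x ∷ xs) u≤v = +-mono-≤ (𝟙≥-antitone x u≤v) (count≥-antitone xs u≤v)

count≥≤length : ∀ v (xs : List (Fin k)) → count≥ v xs ≤ length xs
count≥≤length v xs = ≤-trans (count≥-antitone xs z≤n) (≤-reflexive (count≥-zero xs))

count≥-all-below : ∀ {v} {xs : List (Fin k)} → All (λ x → toℕ x < v) xs → count≥ v xs ≡ 0
count≥-all-below []           = refl
count≥-all-below (x<v ∷ xs<v) = cong₂ _+_ (𝟙≥-no x<v) (count≥-all-below xs<v)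

count≥-beyond : ∀ v → k ≤ v → (xs : List (Fin k)) → count≥ v xs ≡ 0
count≥-beyond v k≤v xs = count≥-all-below (All.universal (λ x → <-≤-trans (toℕ<n x) k≤v) xs)

count≥-suc-++-replicate : ∀ v {z : Fin k} → toℕ z ≡ 0 → ∀ m (xs : List (Fin k)) →
  count≥ (suc v) (xs ++ replicate m z) ≡ count≥ (suc v) xs
count≥-suc-++-replicate v {z} z≡0 m xs = begin
  count≥ (suc v) (xs ++ replicate m z)            ≡⟨ count≥-++ (suc v) xs _ ⟩
  count≥ (suc v) xs + count≥ (suc v) (replicate m z)
    ≡⟨ cong (count≥ (suc v) xs +_) (count≥-all-below (All.replicate⁺ m (subst (_< suc v) (sym z≡0) (s≤s z≤n)))) ⟩
  count≥ (suc v) xs + 0                           ≡⟨ +-identityʳ _ ⟩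
  count≥ (suc v) xs                               ∎
  where open ≡-Reasoning

count≥-mono : ∀ v {xs ys : List (Fin k)} → xs ≼ ys → count≥ v xs ≤ count≥ v ys
count≥-mono v []         = z≤n
count≥-mono v (x≤y ∷ le) = +-mono-≤ (𝟙≥-mono v x≤y) (count≥-mono v le)

count≥-take-++ : ∀ v q (xs ys : List (Fin k)) → count≥ v (take q xs) ≤ count≥ v (take q (xs ++ ys))
count≥-take-++ v q xs ys = begin
  count≥ v (take q xs)                                                ≤⟨ m≤m+n _ _ ⟩
  count≥ v (take q xs) + count≥ v (take (q ∸ length xs) ys)           ≡⟨ count≥-++ v (take q xs) _ ⟨
  count≥ v (take q xs ++ take (q ∸ length xs) ys)                     ≡⟨ cong (count≥ v) (take-++ q xs ys) ⟨
  count≥ v (take q (xs ++ ys))                                        ∎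
  where open ≤-Reasoning

count≥-take-∸ : ∀ v p q (xs : List (Fin k)) → count≥ v (take q xs) ≤ count≥ v (take p xs) + (q ∸ p)
count≥-take-∸ v zero    q       xs       =
  ≤-trans (count≥≤length v (take q xs)) (≤-trans (≤-reflexive (length-take q xs)) (m⊓n≤m q _))
count≥-take-∸ v (suc p) zero    xs       = z≤n
count≥-take-∸ v (suc p) (suc q) []       = z≤n
count≥-take-∸ v (suc p) (suc q) (x ∷ xs) =
  ≤-trans (+-monoʳ-≤ (𝟙≥ v x) (count≥-take-∸ v p q xs)) (≤-reflexive (sym (+-assoc (𝟙≥ v x) _ _)))

count≥-countSteps : ∀ (j : Fin k) xs → count≥ (toℕ j) xs ≡ countSteps j xs + count≥ (suc (toℕ j)) xs
count≥-countSteps j []       = refl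
count≥-countSteps j (x ∷ xs) with x F.≟ j
... | yes refl rewrite 𝟙≥-yes {v = toℕ x} {x} ≤-refl | 𝟙≥-no {v = suc (toℕ x)} {x} ≤-refl =
  cong suc (count≥-countSteps x xs)
... | no  x≢j  = trans (cong₂ _+_ (𝟙≥-suc (toℕ j) (x≢j ∘ toℕ-injective)) (count≥-countSteps j xs))
                       (x∙yz≈y∙xz (𝟙≥ (suc (toℕ j)) x) (countSteps j xs) _)

-- One stage of a turn

move-≼ : ∀ {i m} {xs ys : List (Fin k)} → Move i m xs ys → xs ≼ ys
move-≼ nil                  = []
move-≼ (keep x mv)          = ≤-refl ∷ move-≼ mv
move-≼ (shift x y x≡i y≡1+i mv) = subst₂ _≤_ (sym x≡i) (sym y≡1+i) (n≤1+n _) ∷ move-≼ mv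

count≥-move-target : ∀ {i m} {xs ys : List (Fin k)} → Move i m xs ys → count≥ (suc i) ys ≡ count≥ (suc i) xs + m
count≥-move-target nil = refl
count≥-move-target {i = i} (keep x mv) =
  trans (cong (𝟙≥ (suc i) x +_) (count≥-move-target mv)) (sym (+-assoc (𝟙≥ (suc i) x) _ _))
count≥-move-target {i = i} {suc m} {xs = _ ∷ xs} (shift x y x≡i y≡1+i mv)
  rewrite 𝟙≥-yes {v = suc i} {y} (≤-reflexive (sym y≡1+i))
        | 𝟙≥-no {v = suc i} {x} (≤-reflexive (cong suc x≡i))
        | count≥-move-target mv = sym (+-suc (count≥ (suc i) xs) m)

count≥-move-other : ∀ {i m v} {xs ys : List (Fin k)} → Move i m xs ys → v ≢ suc i → count≥ v ys ≡ count≥ v xs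
count≥-move-other nil                      _ = refl
count≥-move-other (keep x mv)              v≢1+i = cong (𝟙≥ _ x +_) (count≥-move-other mv v≢1+i)
count≥-move-other (shift x y x≡i y≡1+i mv) v≢1+i =
  cong₂ _+_ (𝟙≥-step x≡i y≡1+i v≢1+i) (count≥-move-other mv v≢1+i)

-- Forward i x z: a ball in bin x can still end in bin z once only balls in bins ≥ i are moved.
Forward : ℕ → Fin k → Fin k → Set
Forward i x z = toℕ x ≤ toℕ z × (x ≡ z ⊎ i ≤ toℕ x)

forward-𝟙≥ : ∀ {i} {x z : Fin k} → Forward i x z → 𝟙≥ i x ≡ 𝟙≥ i z
forward-𝟙≥ (_   , inj₁ refl) = refl
forward-𝟙≥ (x≤z , inj₂ i≤x)  = trans (𝟙≥-yes i≤x) (sym (𝟙≥-yes (≤-trans i≤x x≤z)))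

forward-last : ∀ {i} {x z : Fin k} → k ≤ suc i → Forward i x z → x ≡ z
forward-last _   (_ , inj₁ x≡z) = x≡z
forward-last {z = z} k≤1+i (x≤z , inj₂ i≤x) =
  toℕ-injective (≤-antisym x≤z (≤-trans (s≤s⁻¹ (≤-trans (toℕ<n z) k≤1+i)) i≤x))

data Stage (i : ℕ) (x z : Fin k) : Set where
  stay  : Forward (suc i) x z → Stage i x z
  shift : (y : Fin k) → toℕ x ≡ i → toℕ y ≡ suc i → Forward (suc i) y z → Stage i x z

stage : ∀ i {x z : Fin k} → Forward i x z → Stage i x z
stage i (_ , inj₁ refl) = stay (≤-refl , inj₁ refl)
stage i {x} {z} (x≤z , inj₂ i≤x) with suc i ≤? toℕ x | suc i ≤? toℕ z
... | yes i<x | _       = stay (x≤z , inj₂ i<x)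
... | no  i≮x | yes i<z = shift y x≡i y≡1+i (subst (_≤ toℕ z) (sym y≡1+i) i<z , inj₂ (≤-reflexive (sym y≡1+i)))
  where
  x≡i : toℕ x ≡ i
  x≡i = ≤-antisym (s≤s⁻¹ (≰⇒> i≮x)) i≤x
  y : Fin _
  y = fromℕ< (≤-<-trans i<z (toℕ<n z))
  y≡1+i : toℕ y ≡ suc i
  y≡1+i = toℕ-fromℕ< (≤-<-trans i<z (toℕ<n z))
... | no  i≮x | no  i≮z = stay (x≤z , inj₁ x≡z)
  where
  x≡z : x ≡ z
  x≡z = toℕ-injective (≤-antisym x≤z (≤-trans (s≤s⁻¹ (≰⇒> i≮z)) i≤x))

stage-moves : ∀ i {a b : List (Fin k)} → Pointwise (Forward i) a b →
  ∃₂ λ c y → Move i c a y × Pointwise (Forward (suc i)) y b × count≥ (suc i) y ≡ count≥ (suc i) b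
stage-moves i [] = 0 , [] , nil , [] , refl
stage-moves i {x ∷ _} (f ∷ fs) with stage i f | stage-moves i fs
... | stay f′             | c , y , mv , fs′ , eq =
  c , x ∷ y , keep x mv , f′ ∷ fs′ , cong₂ _+_ (forward-𝟙≥ f′) eq
... | shift w x≡i w≡1+i f′ | c , y , mv , fs′ , eq =
  suc c , w ∷ y , shift x w x≡i w≡1+i mv , f′ ∷ fs′ , cong₂ _+_ (forward-𝟙≥ f′) eq

-- Lowering balls

lower : ℕ → ℕ → List (Fin k) → List (Fin k)
lower v c       []       = []
lower v c       (x ∷ xs) with toℕ x Data.Nat.≟ suc v
lower v zero    (x ∷ xs) | yes _ = F.pred x ∷ lower v zero xs
lower v (suc c) (x ∷ xs) | yes _ = x ∷ lower v c xs
lower v c       (x ∷ xs) | no  _ = x ∷ lower v c xs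

toℕ-pred : (x : Fin k) → toℕ (F.pred x) ≡ Data.Nat.pred (toℕ x)
toℕ-pred F.zero    = refl
toℕ-pred (F.suc x) = toℕ-inject₁ x

toℕ-pred-suc : ∀ {v} {x : Fin k} → toℕ x ≡ suc v → toℕ (F.pred x) ≡ v
toℕ-pred-suc {x = x} x≡1+v = trans (toℕ-pred x) (cong Data.Nat.pred x≡1+v)

lower-≼ : ∀ v c (xs : List (Fin k)) → lower v c xs ≼ xs
lower-≼ v c       []       = []
lower-≼ v c       (x ∷ xs) with toℕ x Data.Nat.≟ suc v
lower-≼ v zero    (x ∷ xs) | yes x≡1+v =
  subst₂ _≤_ (sym (toℕ-pred-suc x≡1+v)) (sym x≡1+v) (n≤1+n v) ∷ lower-≼ v zero xs
lower-≼ v (suc c) (x ∷ xs) | yes _ = ≤-refl ∷ lower-≼ v c xs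
lower-≼ v c       (x ∷ xs) | no  _ = ≤-refl ∷ lower-≼ v c xs

take-lower : ∀ v c q (xs : List (Fin k)) → take q (lower v c xs) ≡ lower v c (take q xs)
take-lower v c       zero    xs       = refl
take-lower v c       (suc q) []       = refl
take-lower v c       (suc q) (x ∷ xs) with toℕ x Data.Nat.≟ suc v
take-lower v zero    (suc q) (x ∷ xs) | yes _ = cong (F.pred x ∷_) (take-lower v zero q xs)
take-lower v (suc c) (suc q) (x ∷ xs) | yes _ = cong (x ∷_) (take-lower v c q xs)
take-lower v c       (suc q) (x ∷ xs) | no  _ = cong (x ∷_) (take-lower v c q xs)

count≥-lower-other : ∀ {u} v c (xs : List (Fin k)) → u ≢ suc v → count≥ u (lower v c xs) ≡ count≥ u xs
count≥-lower-other v c       []       _ = refl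
count≥-lower-other v c       (x ∷ xs) u≢1+v with toℕ x Data.Nat.≟ suc v
count≥-lower-other v zero    (x ∷ xs) u≢1+v | yes x≡1+v =
  cong₂ _+_ (sym (𝟙≥-step (toℕ-pred-suc x≡1+v) x≡1+v u≢1+v)) (count≥-lower-other v zero xs u≢1+v)
count≥-lower-other v (suc c) (x ∷ xs) u≢1+v | yes _ = cong (𝟙≥ _ x +_) (count≥-lower-other v c xs u≢1+v)
count≥-lower-other v c       (x ∷ xs) u≢1+v | no  _ = cong (𝟙≥ _ x +_) (count≥-lower-other v c xs u≢1+v)

count≥-lower : ∀ v c (xs : List (Fin k)) →
  count≥ (suc v) (lower v c xs) ≡ count≥ (suc v) xs ⊓ (count≥ (suc (suc v)) xs + c)
count≥-lower v c       []       = refl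
count≥-lower v c       (x ∷ xs) with toℕ x Data.Nat.≟ suc v
count≥-lower v zero    (x ∷ xs) | yes x≡1+v
  rewrite 𝟙≥-no {v = suc v} {F.pred x} (≤-reflexive (cong suc (toℕ-pred-suc x≡1+v)))
        | 𝟙≥-yes {v = suc v} {x} (≤-reflexive (sym x≡1+v))
        | 𝟙≥-no {v = suc (suc v)} {x} (≤-reflexive (cong suc x≡1+v))
        | count≥-lower v zero xs
        | +-identityʳ (count≥ (suc (suc v)) xs)
  = trans (m≥n⇒m⊓n≡n B≤A) (sym (m≥n⇒m⊓n≡n (m≤n⇒m≤1+n B≤A)))
  where
  B≤A : count≥ (suc (suc v)) xs ≤ count≥ (suc v) xs
  B≤A = count≥-antitone xs (n≤1+n (suc v))
count≥-lower v (suc c) (x ∷ xs) | yes x≡1+v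
  rewrite 𝟙≥-yes {v = suc v} {x} (≤-reflexive (sym x≡1+v))
        | 𝟙≥-no {v = suc (suc v)} {x} (≤-reflexive (cong suc x≡1+v))
        | count≥-lower v c xs
        | +-suc (count≥ (suc (suc v)) xs) c
  = refl
count≥-lower v c       (x ∷ xs) | no  x≢1+v = begin
  e + count≥ (suc v) (lower v c xs)                  ≡⟨ cong (e +_) (count≥-lower v c xs) ⟩
  e + (count≥ (suc v) xs ⊓ (count≥ (suc (suc v)) xs + c)) ≡⟨ +-distribˡ-⊓ e _ _ ⟩
  (e + count≥ (suc v) xs) ⊓ (e + (count≥ (suc (suc v)) xs + c))
    ≡⟨ cong₂ (λ a b → (e + count≥ (suc v) xs) ⊓ (a + b)) (𝟙≥-suc (suc v) x≢1+v) refl ⟩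
  (e + count≥ (suc v) xs) ⊓ (𝟙≥ (suc (suc v)) x + (count≥ (suc (suc v)) xs + c))
    ≡⟨ cong ((e + count≥ (suc v) xs) ⊓_) (+-assoc (𝟙≥ (suc (suc v)) x) _ c) ⟨
  (e + count≥ (suc v) xs) ⊓ (𝟙≥ (suc (suc v)) x + count≥ (suc (suc v)) xs + c) ∎
  where
  open ≡-Reasoning
  e : ℕ
  e = 𝟙≥ (suc v) x

-- Dominance of prefix counts

data Differ (x y : A) : List A → List A → Set where
  here  : ∀ r → Differ x y (x ∷ r) (y ∷ r)
  there : ∀ z {u w} → Differ x y u w → Differ x y (z ∷ u) (z ∷ w)

record Dominates (ys xs : List (Fin k)) : Set where
  field
    same-count : ∀ v → count≥ v ys ≡ count≥ v xs
    prefix-≥   : ∀ v q → count≥ v (take q xs) ≤ count≥ v (take q ys)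

dominates-∷ : ∀ x {ys xs : List (Fin k)} → Dominates ys xs → Dominates (x ∷ ys) (x ∷ xs)
dominates-∷ x d = record
  { same-count = λ v → cong (𝟙≥ v x +_) (same-count v)
  ; prefix-≥   = λ { v zero → z≤n ; v (suc q) → +-monoʳ-≤ (𝟙≥ v x) (prefix-≥ v q) }
  }
  where open Dominates d

differ-count : ∀ v {x y : Fin k} {u w} → Differ x y u w → 𝟙≥ v y + count≥ v u ≡ 𝟙≥ v x + count≥ v w
differ-count v {x} {y} (here r)        = x∙yz≈y∙xz (𝟙≥ v y) (𝟙≥ v x) (count≥ v r)
differ-count v {x} {y} (there z {u} {w} d) = begin
  𝟙≥ v y + (𝟙≥ v z + count≥ v u) ≡⟨ x∙yz≈y∙xz (𝟙≥ v y) (𝟙≥ v z) _ ⟩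
  𝟙≥ v z + (𝟙≥ v y + count≥ v u) ≡⟨ cong (𝟙≥ v z +_) (differ-count v d) ⟩
  𝟙≥ v z + (𝟙≥ v x + count≥ v w) ≡⟨ x∙yz≈y∙xz (𝟙≥ v z) (𝟙≥ v x) _ ⟩
  𝟙≥ v x + (𝟙≥ v z + count≥ v w) ∎
  where open ≡-Reasoning

differ-prefix : ∀ v {x y : Fin k} {u w} → toℕ x ≤ toℕ y → Differ x y u w →
  ∀ q → 𝟙≥ v x + count≥ v (take q w) ≤ 𝟙≥ v y + count≥ v (take q u)
differ-prefix v x≤y d zero = +-monoˡ-≤ 0 (𝟙≥-mono v x≤y)
differ-prefix v {x} {y} x≤y (here r) (suc q) = ≤-reflexive (x∙yz≈y∙xz (𝟙≥ v x) (𝟙≥ v y) _)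
differ-prefix v {x} {y} x≤y (there z d) (suc q) = begin
  𝟙≥ v x + (𝟙≥ v z + _) ≡⟨ x∙yz≈y∙xz (𝟙≥ v x) (𝟙≥ v z) _ ⟩
  𝟙≥ v z + (𝟙≥ v x + _) ≤⟨ +-monoʳ-≤ (𝟙≥ v z) (differ-prefix v x≤y d q) ⟩
  𝟙≥ v z + (𝟙≥ v y + _) ≡⟨ x∙yz≈y∙xz (𝟙≥ v z) (𝟙≥ v y) _ ⟩
  𝟙≥ v y + (𝟙≥ v z + _) ∎
  where open ≤-Reasoning

dominates-exchange : ∀ {x y : Fin k} {u w} → toℕ x ≤ toℕ y → Differ x y u w → Dominates (y ∷ u) (x ∷ w)
dominates-exchange x≤y d = record
  { same-count = λ v → differ-count v d
  ; prefix-≥   = λ { v zero → z≤n ; v (suc q) → differ-prefix v x≤y d q }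
  }

differ-tabulate : ∀ {x : A} (w : List A) (j : Fin (length w)) {g : Fin (length w) → A} →
  g j ≡ x → (∀ p → p ≢ j → g p ≡ lookup w p) → Differ x (lookup w j) (tabulate g) w
differ-tabulate (z ∷ w) F.zero {g} gj≡x elsewhere =
  subst₂ (λ a r → Differ _ z (a ∷ r) (z ∷ w)) (sym gj≡x) (sym tail≡w) (here w)
  where
  tail≡w : tabulate (g ∘ F.suc) ≡ w
  tail≡w = trans (tabulate-cong (λ p → elsewhere (F.suc p) λ ())) (tabulate-lookup w)
differ-tabulate (z ∷ w) (F.suc j) {g} gj≡x elsewhere =
  subst (λ a → Differ _ (lookup w j) (a ∷ tabulate (g ∘ F.suc)) (z ∷ w)) (sym (elsewhere F.zero λ ()))
    (there z (differ-tabulate w j gj≡x (λ p p≢j → elsewhere (F.suc p) (p≢j ∘ fsuc-injective))))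

record Swapped {n} (f g : Fin n → A) (i j : Fin n) : Set where
  field
    at-i      : g i ≡ f j
    at-j      : g j ≡ f i
    elsewhere : ∀ p → p ≢ i → p ≢ j → g p ≡ f p

-- Abstracting p ≟ i and p ≟ j also abstracts them in the selector of swapSteps, so each case computes.
swapSteps-swapped : ∀ (π : List A) (i j : Fin (length π)) → i ≢ j →
  ∀ {h} → swapSteps π i j ≡ tabulate h → Swapped (lookup π) h i j
swapSteps-swapped π i j i≢j {h} e = record { at-i = at-i ; at-j = at-j ; elsewhere = elsewhere }
  where
  entries : Pointwise _≡_ (swapSteps π i j) (tabulate h)
  entries = Pointwise.≡⇒Pointwise-≡ e
  at-i : h i ≡ lookup π j
  at-i with i F.≟ i | i F.≟ j | Pointwise.tabulate⁻ entries i
  ... | yes _   | _ | e′ = sym e′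
  ... | no  i≢i | _ | _  = contradiction refl i≢i
  at-j : h j ≡ lookup π i
  at-j with j F.≟ i | j F.≟ j | Pointwise.tabulate⁻ entries j
  ... | yes j≡i | _       | _  = contradiction (sym j≡i) i≢j
  ... | no  _   | yes _   | e′ = sym e′
  ... | no  _   | no  j≢j | _  = contradiction refl j≢j
  elsewhere : ∀ p → p ≢ i → p ≢ j → h p ≡ lookup π p
  elsewhere p p≢i p≢j with p F.≟ i | p F.≟ j | Pointwise.tabulate⁻ entries p
  ... | yes p≡i | _       | _  = contradiction p≡i p≢i
  ... | no  _   | yes p≡j | _  = contradiction p≡j p≢j
  ... | no  _   | no  _   | e′ = sym e′

dominates-swapped : ∀ (π : List (Fin k)) (i j : Fin (length π)) {h} → toℕ i < toℕ j →
  toℕ (lookup π i) ≤ toℕ (lookup π j) → Swapped (lookup π) h i j → Dominates (tabulate h) π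
dominates-swapped (x ∷ π) F.zero (F.suc j) {h} _ x≤y s =
  subst (λ a → Dominates (a ∷ tabulate (h ∘ F.suc)) (x ∷ π)) (sym at-i)
    (dominates-exchange x≤y (differ-tabulate π j at-j (λ p p≢j → elsewhere (F.suc p) (λ ()) (p≢j ∘ fsuc-injective))))
  where open Swapped s
dominates-swapped (x ∷ π) (F.suc i) (F.suc j) {h} (s≤s i<j) x≤y s =
  subst (λ a → Dominates (a ∷ tabulate (h ∘ F.suc)) (x ∷ π)) (sym (elsewhere F.zero (λ ()) (λ ())))
    (dominates-∷ x (dominates-swapped π i j i<j x≤y record
      { at-i = at-i ; at-j = at-j
      ; elsewhere = λ p p≢i p≢j → elsewhere (F.suc p) (p≢i ∘ fsuc-injective) (p≢j ∘ fsuc-injective) }))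
  where open Swapped s

swapSteps-dominates : ∀ (π : List (Fin k)) (i j : Fin (length π)) → toℕ i < toℕ j →
  toℕ (lookup π i) ≤ toℕ (lookup π j) → Dominates (swapSteps π i j) π
swapSteps-dominates π i j i<j πᵢ≤πⱼ =
  dominates-swapped π i j i<j πᵢ≤πⱼ (swapSteps-swapped π i j (λ i≡j → <-irrefl (cong toℕ i≡j) i<j) refl)

-- The completion

countSteps-++ : ∀ (j : Fin k) xs ys → countSteps j (xs ++ ys) ≡ countSteps j xs + countSteps j ys
countSteps-++ j []       ys = refl
countSteps-++ j (x ∷ xs) ys with x F.≟ j
... | yes _ = cong suc (countSteps-++ j xs ys)
... | no  _ = countSteps-++ j xs ys

countSteps-reverse : ∀ (j : Fin k) xs → countSteps j (reverse xs) ≡ countSteps j xs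
countSteps-reverse j []       = refl
countSteps-reverse j (x ∷ xs) = begin
  countSteps j (reverse (x ∷ xs))                ≡⟨ cong (countSteps j) (unfold-reverse x xs) ⟩
  countSteps j (reverse xs ++ [ x ])             ≡⟨ countSteps-++ j (reverse xs) [ x ] ⟩
  countSteps j (reverse xs) + countSteps j [ x ] ≡⟨ cong (_+ countSteps j [ x ]) (countSteps-reverse j xs) ⟩
  countSteps j xs + countSteps j [ x ]           ≡⟨ +-comm (countSteps j xs) _ ⟩
  countSteps j [ x ] + countSteps j xs           ≡⟨ countSteps-++ j [ x ] xs ⟨
  countSteps j (x ∷ xs)                          ∎
  where open ≡-Reasoning

countSteps-replicate-self : ∀ (j : Fin k) m → countSteps j (replicate m j) ≡ m
countSteps-replicate-self j zero    = refl
countSteps-replicate-self j (suc m) with j F.≟ j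
... | yes _   = cong suc (countSteps-replicate-self j m)
... | no  j≢j = contradiction refl j≢j

countSteps-replicate-other : ∀ {i j : Fin k} m → i ≢ j → countSteps j (replicate m i) ≡ 0
countSteps-replicate-other zero    _   = refl
countSteps-replicate-other {i = i} {j} (suc m) i≢j with i F.≟ j
... | yes i≡j = contradiction i≡j i≢j
... | no  _   = countSteps-replicate-other m i≢j

countSteps-tabulate-suc : ∀ {m} (j : Fin k) (f : Fin m → Fin k) →
  countSteps (F.suc j) (tabulate (F.suc ∘ f)) ≡ countSteps j (tabulate f)
countSteps-tabulate-suc {m = zero}  j f = refl
countSteps-tabulate-suc {m = suc m} j f with f F.zero F.≟ j
... | yes _ = cong suc (countSteps-tabulate-suc j (f ∘ F.suc))
... | no  _ = countSteps-tabulate-suc j (f ∘ F.suc)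

countSteps-zero-tabulate-suc : ∀ {m} (f : Fin m → Fin k) → countSteps F.zero (tabulate (F.suc ∘ f)) ≡ 0
countSteps-zero-tabulate-suc {m = zero}  f = refl
countSteps-zero-tabulate-suc {m = suc m} f = countSteps-zero-tabulate-suc (f ∘ F.suc)

countSteps-allFin : ∀ m (j : Fin m) → countSteps j (allFin m) ≡ 1
countSteps-allFin (suc m) F.zero    = cong suc (countSteps-zero-tabulate-suc {m = m} id)
countSteps-allFin (suc m) (F.suc j) = trans (countSteps-tabulate-suc j id) (countSteps-allFin m j)

blocks : (Fin k → ℕ) → List (Fin k) → List (Fin k)
blocks a js = concat (map (λ i → replicate (a i) i) js)

countSteps-blocks : ∀ (a : Fin k → ℕ) (j : Fin k) js → countSteps j (blocks a js) ≡ countSteps j js * a j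
countSteps-blocks a j []       = refl
countSteps-blocks a j (i ∷ js) with i F.≟ j
... | yes refl = trans (countSteps-++ i (replicate (a i) i) _)
                       (cong₂ _+_ (countSteps-replicate-self i (a i)) (countSteps-blocks a i js))
... | no  i≢j  = trans (countSteps-++ j (replicate (a i) i) _)
                       (cong₂ _+_ (countSteps-replicate-other (a i) i≢j) (countSteps-blocks a j js))

countSteps-completion : ∀ {k} (l : Vec ℕ k) N π′ (j : Fin k) →
  countSteps j (completion l N π′) ≡ N * Data.Vec.lookup l j ∸ countSteps j π′
countSteps-completion {k} l N π′ j = begin
  countSteps j (completion l N π′)                  ≡⟨ countSteps-blocks _ j (reverse (allFin k)) ⟩
  countSteps j (reverse (allFin k)) * gap           ≡⟨ cong (_* gap) (countSteps-reverse j (allFin k)) ⟩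
  countSteps j (allFin k) * gap                     ≡⟨ cong (_* gap) (countSteps-allFin k j) ⟩
  1 * gap                                           ≡⟨ *-identityˡ gap ⟩
  gap                                               ∎
  where
  open ≡-Reasoning
  gap : ℕ
  gap = N * Data.Vec.lookup l j ∸ countSteps j π′

Descending : List (Fin k) → Set
Descending = AllPairs (λ x y → toℕ y ≤ toℕ x)

count≥-take-descending : ∀ {d : List (Fin k)} → Descending d → ∀ v r → count≥ v (take r d) ≡ r ⊓ count≥ v d
count≥-take-descending _  v zero = refl
count≥-take-descending [] v (suc r) = refl
count≥-take-descending {d = x ∷ d} (x≥d ∷ d↓) v (suc r) with v ≤? toℕ x
... | yes _   = cong suc (count≥-take-descending d↓ v r)
... | no  v≰x = trans (count≥-all-below (All.take⁺ r d<v)) (cong (suc r ⊓_) (sym (count≥-all-below d<v)))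
  where
  d<v : All (λ y → toℕ y < v) d
  d<v = All.map (λ y≤x → ≤-<-trans y≤x (≰⇒> v≰x)) x≥d

replicate-++-descending : ∀ {i : Fin k} {ys} m → All (λ y → toℕ y ≤ toℕ i) ys → Descending ys →
  Descending (replicate m i ++ ys)
replicate-++-descending zero    _    ys↓ = ys↓
replicate-++-descending (suc m) i≥ys ys↓ =
  All.++⁺ (All.replicate⁺ m ≤-refl) i≥ys ∷ replicate-++-descending m i≥ys ys↓

blocks-descending : ∀ (a : Fin k → ℕ) {js} → Descending js → Descending (blocks a js)
blocks-descending a []                      = []
blocks-descending a {i ∷ js} (i≥js ∷ js↓) =
  replicate-++-descending (a i) i≥blocks (blocks-descending a js↓)
  where
  i≥blocks : All (λ y → toℕ y ≤ toℕ i) (blocks a js)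
  i≥blocks = All.concat⁺ (All.map⁺ (All.map (λ {j} j≤i → All.replicate⁺ (a j) j≤i) i≥js))

completion-descending : ∀ {k} (l : Vec ℕ k) N π′ → Descending (completion l N π′)
completion-descending l N π′ = blocks-descending _ (AllPairs-reverse (AllPairs.tabulate⁺-< <⇒≤))

module Configurations {k : ℕ} (l : Vec ℕ k) where

  L : ℕ
  L = totalL l

  T : ℕ → ℕ
  T = tailSum l

  -- l_{v+1}, and 0 for v ≥ k
  lᵥ : ℕ → ℕ
  lᵥ v = fromMaybe 0 (Data.List.head (drop v (toList l)))

  T-suc : ∀ v → T v ≡ lᵥ v + T (suc v)
  T-suc v = sum-drop v (toList l)

  *-T-suc : ∀ t v → t * T v ≡ t * T (suc v) + t * lᵥ v
  *-T-suc t v = trans (cong (t *_) (trans (T-suc v) (+-comm (lᵥ v) _))) (*-distribˡ-+ t _ _)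

  T-lookup : ∀ (j : Fin k) → T (toℕ j) ≡ Data.Vec.lookup l j + T (suc (toℕ j))
  T-lookup j = trans (T-suc (toℕ j)) (cong (_+ T (suc (toℕ j))) (lᵥ-lookup l j))
    where
    lᵥ-lookup : ∀ {m} (u : Vec ℕ m) (j : Fin m) →
      fromMaybe 0 (Data.List.head (drop (toℕ j) (toList u))) ≡ Data.Vec.lookup u j
    lᵥ-lookup (a Data.Vec.∷ u) F.zero    = refl
    lᵥ-lookup (a Data.Vec.∷ u) (F.suc j) = lᵥ-lookup u j

  T-beyond : ∀ v → k ≤ v → T v ≡ 0
  T-beyond v k≤v = cong sum (drop-all v (toList l) (≤-trans (≤-reflexive (length-toList l)) k≤v))

  T≤L : ∀ v → T v ≤ L
  T≤L zero    = ≤-refl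
  T≤L (suc v) = ≤-trans (≤-trans (m≤n+m (T (suc v)) (lᵥ v)) (≤-reflexive (sym (T-suc v)))) (T≤L v)

  count≥-beyond-k : ∀ N (xs : List (Fin k)) v → k ≤ v → count≥ v xs ≡ N * T v
  count≥-beyond-k N xs v k≤v =
    trans (count≥-beyond v k≤v xs) (sym (trans (cong (N *_) (T-beyond v k≤v)) (*-zeroʳ N)))

  count≥-from-countSteps : ∀ N (σ : List (Fin k)) → (∀ j → countSteps j σ ≡ N * Data.Vec.lookup l j) →
    ∀ v → count≥ v σ ≡ N * T v
  count≥-from-countSteps N σ counts = downward-induction Exact k (count≥-beyond-k N σ) below
    where
    Exact : ℕ → Set
    Exact v = count≥ v σ ≡ N * T v
    at : (j : Fin k) → Exact (suc (toℕ j)) → Exact (toℕ j)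
    at j ih = begin
      count≥ (toℕ j) σ                                ≡⟨ count≥-countSteps j σ ⟩
      countSteps j σ + count≥ (suc (toℕ j)) σ          ≡⟨ cong₂ _+_ (counts j) ih ⟩
      N * Data.Vec.lookup l j + N * T (suc (toℕ j))    ≡⟨ *-distribˡ-+ N _ _ ⟨
      N * (Data.Vec.lookup l j + T (suc (toℕ j)))      ≡⟨ cong (N *_) (T-lookup j) ⟨
      N * T (toℕ j)                                   ∎
      where open ≡-Reasoning
    below : ∀ v → v < k → Exact (suc v) → Exact v
    below v v<k = subst (λ u → Exact (suc u) → Exact u) (toℕ-fromℕ< v<k) (at (fromℕ< v<k))

  movesFrom-≼ : ∀ {i} {xs ys : List (Fin k)} → MovesFrom l i xs ys → xs ≼ ys
  movesFrom-≼ (done _)       = Pointwise.refl ≤-refl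
  movesFrom-≼ (step _ mv ms) = Pointwise.transitive ≤-trans (move-≼ mv) (movesFrom-≼ ms)

  count≥-movesFrom-below : ∀ {i v} {xs ys : List (Fin k)} → MovesFrom l i xs ys → v ≤ i →
    count≥ v ys ≡ count≥ v xs
  count≥-movesFrom-below (done _)       v≤i = refl
  count≥-movesFrom-below (step _ mv ms) v≤i =
    trans (count≥-movesFrom-below ms (m≤n⇒m≤1+n v≤i)) (count≥-move-other mv (λ v≡1+i → <-irrefl v≡1+i (s≤s v≤i)))

  count≥-movesFrom-above : ∀ {i v} {xs ys : List (Fin k)} → MovesFrom l i xs ys → i < v →
    count≥ v ys ≡ count≥ v xs + T v
  count≥-movesFrom-above {xs = xs} (done k≤1+i) i<v =
    sym (trans (cong (count≥ _ xs +_) (T-beyond _ (≤-trans k≤1+i i<v))) (+-identityʳ _))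
  count≥-movesFrom-above {v = v} (step _ mv ms) i<v with m≤n⇒m<n∨m≡n i<v
  ... | inj₁ 1+i<v = trans (count≥-movesFrom-above ms 1+i<v)
                           (cong (_+ T v) (count≥-move-other mv (λ v≡1+i → <-irrefl (sym v≡1+i) 1+i<v)))
  ... | inj₂ refl  = trans (count≥-movesFrom-below ms ≤-refl) (count≥-move-target mv)

  PrefixBound : ℕ → List (Fin k) → Set
  PrefixBound N σ = ∀ v t → t ≤ N → t * T v ≤ count≥ v (take (t * L) σ)

  record Admissible (N : ℕ) (σ : List (Fin k)) : Set where
    field
      total  : ∀ v → count≥ v σ ≡ N * T v
      prefix : PrefixBound N σ

  open Admissible

  length-admissible : ∀ {N σ} → Admissible N σ → length σ ≡ N * L
  length-admissible {σ = σ} adm = trans (sym (count≥-zero σ)) (total adm 0)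

  reachable⇒admissible : ∀ {N σ} → Reachable l N σ → Admissible N σ
  reachable⇒admissible start = record { total = λ _ → refl ; prefix = λ { _ zero _ → z≤n } }
  reachable⇒admissible (turn {t = M} {s = τ} {s' = σ} z z≡0 r ms) = record { total = total-σ ; prefix = prefix-σ }
    where
    τ-adm : Admissible M τ
    τ-adm = reachable⇒admissible r
    total-σ : ∀ v → count≥ v σ ≡ suc M * T v
    total-σ zero = begin
      count≥ 0 σ                                 ≡⟨ count≥-movesFrom-below ms ≤-refl ⟩
      count≥ 0 (τ ++ replicate L z)              ≡⟨ count≥-++ 0 τ _ ⟩
      count≥ 0 τ + count≥ 0 (replicate L z)
        ≡⟨ cong₂ _+_ (total τ-adm 0) (trans (count≥-zero (replicate L z)) (length-replicate L)) ⟩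
      M * L + L                                  ≡⟨ +-comm (M * L) L ⟩
      L + M * L                                  ∎
      where open ≡-Reasoning
    total-σ (suc v) = begin
      count≥ (suc v) σ                                 ≡⟨ count≥-movesFrom-above ms (s≤s z≤n) ⟩
      count≥ (suc v) (τ ++ replicate L z) + T (suc v)  ≡⟨ cong (_+ T (suc v)) (count≥-suc-++-replicate v z≡0 L τ) ⟩
      count≥ (suc v) τ + T (suc v)                     ≡⟨ cong (_+ T (suc v)) (total τ-adm (suc v)) ⟩
      M * T (suc v) + T (suc v)                        ≡⟨ +-comm (M * T (suc v)) _ ⟩
      T (suc v) + M * T (suc v)                        ∎
      where open ≡-Reasoning
    prefix-σ : PrefixBound (suc M) σ
    prefix-σ v t t≤1+M with m≤n⇒m<n∨m≡n t≤1+M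
    ... | inj₁ (s≤s t≤M) = begin
      t * T v                                          ≤⟨ prefix τ-adm v t t≤M ⟩
      count≥ v (take (t * L) τ)                        ≤⟨ count≥-take-++ v (t * L) τ _ ⟩
      count≥ v (take (t * L) (τ ++ replicate L z))     ≤⟨ count≥-mono v (Pointwise-take (t * L) (movesFrom-≼ ms)) ⟩
      count≥ v (take (t * L) σ)                        ∎
      where open ≤-Reasoning
    ... | inj₂ refl = ≤-reflexive (sym (trans (cong (count≥ v) σ-whole) (total-σ v)))
      where
      σ-whole : take (suc M * L) σ ≡ σ
      σ-whole = take-all _ σ (≤-reflexive (trans (sym (count≥-zero σ)) (total-σ 0)))

  forward-moves : ∀ i → ∀ {a b} → Pointwise (Forward i) a b →
    (∀ v → i < v → count≥ v b ≡ count≥ v a + T v) → MovesFrom l i a b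
  forward-moves = downward-induction TurnFrom k (λ i k≤i fs _ → finished (m≤n⇒m≤1+n k≤i) fs) extend
    where
    TurnFrom : ℕ → Set
    TurnFrom i = ∀ {a b} → Pointwise (Forward i) a b →
      (∀ v → i < v → count≥ v b ≡ count≥ v a + T v) → MovesFrom l i a b
    finished : ∀ {i a b} → k ≤ suc i → Pointwise (Forward i) a b → MovesFrom l i a b
    finished {i} {a} k≤1+i fs =
      subst (MovesFrom l i a) (Pointwise.Pointwise-≡⇒≡ (Pointwise.map (forward-last k≤1+i) fs)) (done k≤1+i)
    extend : ∀ i → i < k → TurnFrom (suc i) → TurnFrom i
    extend i _ next {a} {b} fs counts with k ≤? suc i | stage-moves i fs
    ... | yes k≤1+i | _ = finished k≤1+i fs
    ... | no  k≰1+i | c , y , mv , fs′ , eq =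
      step (≰⇒> k≰1+i) (subst (λ c → Move i c a y) c≡T mv) (next fs′ counts′)
      where
      c≡T : c ≡ T (suc i)
      c≡T = +-cancelˡ-≡ (count≥ (suc i) a) c (T (suc i))
              (trans (sym (count≥-move-target mv)) (trans eq (counts (suc i) ≤-refl)))
      counts′ : ∀ v → suc i < v → count≥ v b ≡ count≥ v y + T v
      counts′ v 1+i<v = trans (counts v (<-trans (n<1+n i) 1+i<v))
        (cong (_+ T v) (sym (count≥-move-other mv (λ v≡1+i → <-irrefl (sym v≡1+i) 1+i<v))))

  lowerLevels : ℕ → ℕ → List (Fin k) → List (Fin k)
  lowerLevels M zero    xs = xs
  lowerLevels M (suc v) xs = lowerLevels M v (lower v (M * lᵥ (suc v)) xs)

  lower-total : ∀ M v {xs} → length xs ≡ M * L → PrefixBound M xs →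
    count≥ (suc (suc v)) xs ≡ M * T (suc (suc v)) → count≥ (suc v) (lower v (M * lᵥ (suc v)) xs) ≡ M * T (suc v)
  lower-total M v {xs} length-xs bound above = begin
    count≥ (suc v) (lower v (M * lᵥ (suc v)) xs)                        ≡⟨ count≥-lower v _ xs ⟩
    count≥ (suc v) xs ⊓ (count≥ (suc (suc v)) xs + M * lᵥ (suc v))
      ≡⟨ cong (λ a → count≥ (suc v) xs ⊓ (a + M * lᵥ (suc v))) above ⟩
    count≥ (suc v) xs ⊓ (M * T (suc (suc v)) + M * lᵥ (suc v))          ≡⟨ cong (count≥ (suc v) xs ⊓_) (*-T-suc M (suc v)) ⟨
    count≥ (suc v) xs ⊓ (M * T (suc v))                                 ≡⟨ m≥n⇒m⊓n≡n enough ⟩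
    M * T (suc v)                                                       ∎
    where
    open ≡-Reasoning
    enough : M * T (suc v) ≤ count≥ (suc v) xs
    enough = subst (λ ys → M * T (suc v) ≤ count≥ (suc v) ys) (take-all (M * L) xs (≤-reflexive length-xs))
               (bound (suc v) M ≤-refl)

  lower-prefixBound : ∀ M v {xs} → PrefixBound M xs → PrefixBound M (lower v (M * lᵥ (suc v)) xs)
  lower-prefixBound M v {xs} bound u t t≤M with u Data.Nat.≟ suc v
  ... | yes refl = begin
    t * T (suc v)                                                  ≤⟨ ⊓-glb (bound (suc v) t t≤M) raised ⟩
    count≥ (suc v) xs′ ⊓ (count≥ (suc (suc v)) xs′ + M * lᵥ (suc v)) ≡⟨ count≥-lower v _ xs′ ⟨
    count≥ (suc v) (lower v _ xs′)                                 ≡⟨ cong (count≥ (suc v)) (take-lower v _ q xs) ⟨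
    count≥ (suc v) (take q (lower v _ xs))                         ∎
    where
    open ≤-Reasoning
    q : ℕ
    q = t * L
    xs′ : List (Fin k)
    xs′ = take q xs
    raised : t * T (suc v) ≤ count≥ (suc (suc v)) xs′ + M * lᵥ (suc v)
    raised = ≤-trans (≤-reflexive (*-T-suc t (suc v)))
               (+-mono-≤ (bound (suc (suc v)) t t≤M) (*-monoˡ-≤ (lᵥ (suc v)) t≤M))
  ... | no u≢1+v = subst (t * T u ≤_) (sym unchanged) (bound u t t≤M)
    where
    unchanged : count≥ u (take (t * L) (lower v _ xs)) ≡ count≥ u (take (t * L) xs)
    unchanged = trans (cong (count≥ u) (take-lower v _ (t * L) xs))
                      (count≥-lower-other v (M * lᵥ (suc v)) (take (t * L) xs) u≢1+v)

  lowerLevels-admissible : ∀ M v {xs} → length xs ≡ M * L → PrefixBound M xs →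
    (∀ u → v < u → count≥ u xs ≡ M * T u) → Admissible M (lowerLevels M v xs) × lowerLevels M v xs ≼ xs
  lowerLevels-admissible M zero {xs} length-xs bound above = adm , Pointwise.refl ≤-refl
    where
    adm : Admissible M xs
    adm = record
      { total  = λ { zero → trans (count≥-zero xs) length-xs ; (suc u) → above (suc u) (s≤s z≤n) }
      ; prefix = bound }
  lowerLevels-admissible M (suc v) {xs} length-xs bound above =
    map₂ (λ ≼ys → Pointwise.transitive ≤-trans ≼ys (lower-≼ v c xs))
      (lowerLevels-admissible M v (trans (Pointwise-length (lower-≼ v c xs)) length-xs)
        (lower-prefixBound M v bound) above′)
    where
    c : ℕ
    c = M * lᵥ (suc v)
    above′ : ∀ u → v < u → count≥ u (lower v c xs) ≡ M * T u
    above′ u v<u with m≤n⇒m<n∨m≡n v<u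
    ... | inj₁ 1+v<u = trans (count≥-lower-other v c xs (λ u≡1+v → <-irrefl (sym u≡1+v) 1+v<u)) (above u 1+v<u)
    ... | inj₂ refl  = lower-total M v length-xs bound (above (suc (suc v)) ≤-refl)

  prefixBound-take : ∀ M {σ} → PrefixBound (suc M) σ → PrefixBound M (take (M * L) σ)
  prefixBound-take M {σ} bound u t t≤M =
    subst (λ ys → t * T u ≤ count≥ u ys) (sym take-take-σ) (bound u t (m≤n⇒m≤1+n t≤M))
    where
    take-take-σ : take (t * L) (take (M * L) σ) ≡ take (t * L) σ
    take-take-σ = trans (take-take (t * L) (M * L) σ) (cong (λ q → take q σ) (m≤n⇒m⊓n≡m (*-monoˡ-≤ L t≤M)))

  admissible⇒reachable : 0 < k → ∀ N {σ} → Admissible N σ → Reachable l N σ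
  admissible⇒reachable _ zero {[]} _ = start
  admissible⇒reachable _ zero {x ∷ σ} adm with length-admissible adm
  ... | ()
  admissible⇒reachable 0<k (suc M) {σ} adm =
    subst (Reachable l (suc M)) (take++drop≡id (M * L) σ)
      (turn z₀ z₀≡0 (admissible⇒reachable 0<k M (proj₁ lowered)) (forward-moves 0 forward counts))
    where
    z₀ : Fin k
    z₀ = fromℕ< 0<k
    z₀≡0 : toℕ z₀ ≡ 0
    z₀≡0 = toℕ-fromℕ< 0<k
    ρ rest τ : List (Fin k)
    ρ = take (M * L) σ
    rest = drop (M * L) σ
    τ = lowerLevels M k ρ
    length-σ : length σ ≡ L + M * L
    length-σ = length-admissible adm
    length-ρ : length ρ ≡ M * L
    length-ρ = trans (length-take (M * L) σ) (m≤n⇒m⊓n≡m (subst (M * L ≤_) (sym length-σ) (m≤n+m (M * L) L)))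
    length-rest : length rest ≡ L
    length-rest = trans (length-drop (M * L) σ) (trans (cong (_∸ M * L) length-σ) (m+n∸n≡m L (M * L)))
    lowered : Admissible M τ × τ ≼ ρ
    lowered = lowerLevels-admissible M k length-ρ (prefixBound-take M (prefix adm))
      (λ u k<u → count≥-beyond-k M ρ u (<⇒≤ k<u))
    forward : Pointwise (Forward 0) (τ ++ replicate L z₀) (ρ ++ rest)
    forward = Pointwise.map (_, inj₂ z≤n)
      (Pointwise.++⁺ (proj₂ lowered) (subst (λ m → replicate m z₀ ≼ rest) length-rest
        (Pointwise-replicateˡ (λ {y} → subst (_≤ toℕ y) (sym z₀≡0) z≤n) rest)))
    counts : ∀ v → 0 < v → count≥ v (ρ ++ rest) ≡ count≥ v (τ ++ replicate L z₀) + T v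
    counts (suc v) _ = begin
      count≥ (suc v) (ρ ++ rest)                         ≡⟨ cong (count≥ (suc v)) (take++drop≡id (M * L) σ) ⟩
      count≥ (suc v) σ                                   ≡⟨ total adm (suc v) ⟩
      T (suc v) + M * T (suc v)                          ≡⟨ +-comm (T (suc v)) _ ⟩
      M * T (suc v) + T (suc v)                          ≡⟨ cong (_+ T (suc v)) (total (proj₁ lowered) (suc v)) ⟨
      count≥ (suc v) τ + T (suc v)                       ≡⟨ cong (_+ T (suc v)) (count≥-suc-++-replicate v z₀≡0 L τ) ⟨
      count≥ (suc v) (τ ++ replicate L z₀) + T (suc v)   ∎
      where open ≡-Reasoning

  admissible-dominated : ∀ {N} {xs ys : List (Fin k)} → Dominates ys xs → Admissible N xs → Admissible N ys
  admissible-dominated d adm = record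
    { total  = λ v → trans (same-count v) (total adm v)
    ; prefix = λ v t t≤N → ≤-trans (prefix adm v t t≤N) (prefix-≥ v (t * L)) }
    where open Dominates d

  admissible-take-deficit : ∀ {n π} → Admissible n π → ∀ v t {p} → p ≤ length π →
    t * T v ≤ count≥ v (take p π) + (t * L ∸ p)
  admissible-take-deficit {n} {π} adm v t {p} p≤∣π∣ with t ≤? n
  ... | yes t≤n = ≤-trans (prefix adm v t t≤n) (count≥-take-∸ v p (t * L) π)
  ... | no  t≰n = begin
    t * T v                                       ≡⟨ cong (_* T v) t≡n+d ⟩
    (n + d) * T v                                 ≡⟨ *-distribʳ-+ (T v) n d ⟩
    n * T v + d * T v                             ≤⟨ +-mono-≤ (≤-reflexive (sym (total adm v))) (*-monoʳ-≤ d (T≤L v)) ⟩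
    count≥ v π + d * L                            ≤⟨ +-monoˡ-≤ (d * L) whole ⟩
    count≥ v (take p π) + (n * L ∸ p) + d * L     ≡⟨ +-assoc (count≥ v (take p π)) _ _ ⟩
    count≥ v (take p π) + ((n * L ∸ p) + d * L)   ≡⟨ cong (count≥ v (take p π) +_) (+-∸-comm (d * L) p≤nL) ⟨
    count≥ v (take p π) + (n * L + d * L ∸ p)     ≡⟨ cong (λ a → count≥ v (take p π) + (a ∸ p)) (*-distribʳ-+ L n d) ⟨
    count≥ v (take p π) + ((n + d) * L ∸ p)       ≡⟨ cong (λ a → count≥ v (take p π) + (a * L ∸ p)) t≡n+d ⟨
    count≥ v (take p π) + (t * L ∸ p)             ∎
    where
    open ≤-Reasoning
    d : ℕ
    d = t ∸ n
    t≡n+d : t ≡ n + d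
    t≡n+d = sym (m+[n∸m]≡n (<⇒≤ (≰⇒> t≰n)))
    p≤nL : p ≤ n * L
    p≤nL = ≤-trans p≤∣π∣ (≤-reflexive (length-admissible adm))
    whole : count≥ v π ≤ count≥ v (take p π) + (n * L ∸ p)
    whole = subst₂ (λ ys m → count≥ v ys ≤ count≥ v (take p π) + (m ∸ p))
              (take-all (length π) π ≤-refl) (length-admissible adm) (count≥-take-∸ v p (length π) π)

  admissible-prefix-within : ∀ {n π} → Admissible n π → ∀ v t → t * L ≤ length π →
    t * T v ≤ count≥ v (take (t * L) π)
  admissible-prefix-within {π = π} adm v t tL≤∣π∣ =
    subst (t * T v ≤_) (trans (cong (count≥ v (take (t * L) π) +_) (n∸n≡0 (t * L))) (+-identityʳ _))
      (admissible-take-deficit adm v t tL≤∣π∣)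

  completion-total : ∀ N (π′ : List (Fin k)) → (∀ j → countSteps j π′ ≤ N * Data.Vec.lookup l j) →
    ∀ v → count≥ v (π′ ++ completion l N π′) ≡ N * T v
  completion-total N π′ fits = count≥-from-countSteps N (π′ ++ completion l N π′) λ j → begin
    countSteps j (π′ ++ completion l N π′)                           ≡⟨ countSteps-++ j π′ _ ⟩
    countSteps j π′ + countSteps j (completion l N π′)
      ≡⟨ cong (countSteps j π′ +_) (countSteps-completion l N π′ j) ⟩
    countSteps j π′ + (N * Data.Vec.lookup l j ∸ countSteps j π′)    ≡⟨ m+[n∸m]≡n (fits j) ⟩
    N * Data.Vec.lookup l j                                          ∎
    where open ≡-Reasoning

  -- The part of a prefix lying in the descending completion either contains all of its steps into
  -- Γ_{v+1}, …, Γ_k, so the totals apply, or consists of such steps only, so the bound from π applies.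
  admissible-completion : ∀ {n π} N p → Admissible n π → p ≤ length π →
    (∀ j → countSteps j (take p π) ≤ N * Data.Vec.lookup l j) →
    Admissible N (take p π ++ completion l N (take p π))
  admissible-completion {π = π} N p adm p≤∣π∣ fits =
    record { total = completion-total N π′ fits ; prefix = prefix-σ }
    where
    π′ tail′ : List (Fin k)
    π′ = take p π
    tail′ = completion l N π′
    length-π′ : length π′ ≡ p
    length-π′ = trans (length-take p π) (m≤n⇒m⊓n≡m p≤∣π∣)
    prefix-σ : PrefixBound N (π′ ++ tail′)
    prefix-σ v t t≤N with t * L ≤? p
    ... | yes q≤p =
      subst (λ ys → t * T v ≤ count≥ v ys) (sym take-σ) (admissible-prefix-within adm v t (≤-trans q≤p p≤∣π∣))
      where
      take-σ : take (t * L) (π′ ++ tail′) ≡ take (t * L) π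
      take-σ = trans (take-++ˡ (t * L) π′ tail′ (subst (t * L ≤_) (sym length-π′) q≤p))
                     (trans (take-take (t * L) p π) (cong (λ q → take q π) (m≤n⇒m⊓n≡m q≤p)))
    ... | no  q≰p = begin
      t * T v                                                      ≤⟨ ⊓-glb (admissible-take-deficit adm v t p≤∣π∣) whole ⟩
      (count≥ v π′ + (t * L ∸ p)) ⊓ (count≥ v π′ + count≥ v tail′) ≡⟨ +-distribˡ-⊓ (count≥ v π′) _ _ ⟨
      count≥ v π′ + ((t * L ∸ p) ⊓ count≥ v tail′)
        ≡⟨ cong (count≥ v π′ +_) (count≥-take-descending (completion-descending l N π′) v _) ⟨
      count≥ v π′ + count≥ v (take (t * L ∸ p) tail′)              ≡⟨ count≥-++ v π′ _ ⟨
      count≥ v (π′ ++ take (t * L ∸ p) tail′)                      ≡⟨ cong (count≥ v) take-σ ⟨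
      count≥ v (take (t * L) (π′ ++ tail′))                        ∎
      where
      open ≤-Reasoning
      whole : t * T v ≤ count≥ v π′ + count≥ v tail′
      whole = ≤-trans (*-monoˡ-≤ (T v) t≤N)
                      (≤-reflexive (trans (sym (completion-total N π′ fits v)) (count≥-++ v π′ tail′)))
      take-σ : take (t * L) (π′ ++ tail′) ≡ π′ ++ take (t * L ∸ p) tail′
      take-σ = trans (take-++ʳ (t * L) π′ tail′ (≤-trans (≤-reflexive length-π′) (<⇒≤ (≰⇒> q≰p))))
                     (cong (λ m → π′ ++ take (t * L ∸ m) tail′) length-π′)

corollary3p2 : (k : ℕ) → 2 ≤ k → (l : Vec ℕ k) → (∀ j → 0 < Data.Vec.lookup l j) →
    (n : ℕ) → 1 ≤ n → (π : List (Fin k)) → ConfigPath l n π →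
    ((i j : Fin (length π)) → toℕ i < toℕ j →
       toℕ (lookup π i) ≤ toℕ (lookup π j) →
       ConfigPath l n (swapSteps π i j))
    ×
    ((p : ℕ) → p ≤ length π → (n' : ℕ) →
       (∀ j → countSteps j (take p π) ≤ n' * Data.Vec.lookup l j) →
       (∀ m → (∀ j → countSteps j (take p π) ≤ m * Data.Vec.lookup l j) → n' ≤ m) →
       (n'' : ℕ) →
       ConfigPath l (n' + n'') (take p π Data.List.++ completion l (n' + n'') (take p π)))
corollary3p2 k 2≤k l _ n _ π π-reachable = exchange , complete
  where
  open Configurations l
  0<k : 0 < k
  0<k = ≤-trans (s≤s z≤n) 2≤k
  π-admissible : Admissible n π
  π-admissible = reachable⇒admissible π-reachable
  exchange : (i j : Fin (length π)) → toℕ i < toℕ j → toℕ (lookup π i) ≤ toℕ (lookup π j) →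
    ConfigPath l n (swapSteps π i j)
  exchange i j i<j πᵢ≤πⱼ =
    admissible⇒reachable 0<k n (admissible-dominated (swapSteps-dominates π i j i<j πᵢ≤πⱼ) π-admissible)
  complete : (p : ℕ) → p ≤ length π → (n' : ℕ) →
    (∀ j → countSteps j (take p π) ≤ n' * Data.Vec.lookup l j) →
    (∀ m → (∀ j → countSteps j (take p π) ≤ m * Data.Vec.lookup l j) → n' ≤ m) →
    (n'' : ℕ) → ConfigPath l (n' + n'') (take p π ++ completion l (n' + n'') (take p π))
  complete p p≤∣π∣ n' fits _ n'' =
    admissible⇒reachable 0<k (n' + n'')
      (admissible-completion (n' + n'') p π-admissible p≤∣π∣
        (λ j → ≤-trans (fits j) (*-monoˡ-≤ _ (m≤m+n n' n''))))
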